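{- Let $M=(E,\mathcal{I})$ be an independence system on a finite set $E$ with rank function $r_M$, let $M^*$ be its dual, with rank function $r_{M^*}$, and let $r_M^\perp(X):=|X|+r_M(E\setminus X)-r_M(E)$. Then for every $X\subseteq E$, $$r_{M^*}(X)=\max_{B\in\mathcal{B}(M)}|X\setminus B|=|X|-\min_{B\in\mathcal{B}(M)}|X\cap B|.$$ Moreover, the following are equivalent: (1) $r_{M^*}=r_M^\perp$; (2) $r_M(X)=\max_{B\in\mathcal{B}(M)}|X\cap B|$ for all $X\subseteq E$; (3) every independent set of $M$ is contained in a basis of $M$; (4) $M$ is pure. Under these equivalent conditions, $M^{**}=M$.
   Context: An independence system $(E,\mathcal{I})$ has $\emptyset\in\mathcal{I}$ and $\mathcal{I}$ closed under subsets; its rank function is $r_M(X)=\max\{|I|:I\subseteq X, I\in\mathcal{I}\}$. Its dual is $M^*=(E,\mathcal{I}^*)$ with $\mathcal{I}^*=\{X\subseteq E: r_M^\perp(X)=|X|\}$. The bases of $M$ are $\mathcal{B}(M)=\{B\in\mathcal{I}:|B|=r_M(E)\}$. $M$ is pure if all maximal independent sets have the same cardinality. -}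

module Defs where

open import Data.Nat using (ℕ; zero; suc; _+_; _∸_; _⊔_; _⊓_; _≡ᵇ_)
open import Data.Bool using (Bool; true; false; _∧_; not)
open import Data.List using (List; []; _∷_; _++_; map; filter)
open import Data.Vec using ([]; _∷_)
open import Data.Fin.Subset using (Subset; inside; outside; ⊤; ⊥; ∁; _∩_; _─_; _⊆_; ∣_∣)
open import Data.Product using (Σ; _×_)
open import Relation.Binary.PropositionalEquality using (_≡_)
open import Relation.Nullary.Decidable using (T?)

-- Ground set E = Fin n; subsets of E are Subset n.
-- An independence "family" is given by its (decidable) membership test.
IndepFamily : ℕ → Set
IndepFamily n = Subset n → Bool

IsIndepSystem : ∀ {n} → IndepFamily n → Set
IsIndepSystem {n} I =
  (I ⊥ ≡ true) × (∀ (X Y : Subset n) → Y ⊆ X → I X ≡ true → I Y ≡ true)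

allSubsets : ∀ n → List (Subset n)
allSubsets zero = [] ∷ []
allSubsets (suc n) = map (inside ∷_) (allSubsets n) ++ map (outside ∷_) (allSubsets n)

subsetᵇ : ∀ {n} → Subset n → Subset n → Bool
subsetᵇ [] [] = true
subsetᵇ (inside ∷ p) (outside ∷ q) = false
subsetᵇ (inside ∷ p) (inside ∷ q) = subsetᵇ p q
subsetᵇ (outside ∷ p) (_ ∷ q) = subsetᵇ p q

maxOver : ∀ {A : Set} → (A → ℕ) → List A → ℕ
maxOver f [] = 0
maxOver f (a ∷ as) = f a ⊔ maxOver f as

-- min of f over a list (0 for the empty list; only used on nonempty lists).
minOver : ∀ {A : Set} → (A → ℕ) → List A → ℕ
minOver f [] = 0
minOver f (a ∷ []) = f a
minOver f (a ∷ b ∷ as) = f a ⊓ minOver f (b ∷ as)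

rank : ∀ {n} → IndepFamily n → Subset n → ℕ
rank {n} I X = maxOver ∣_∣ (filter (λ Y → T? (I Y ∧ subsetᵇ Y X)) (allSubsets n))

-- r_M^⊥(X) = |X| + r_M(E \ X) - r_M(E)  (the subtraction never truncates
-- for an independence system, since r_M(E) ≤ |X| + r_M(E \ X)).
rankPerp : ∀ {n} → IndepFamily n → Subset n → ℕ
rankPerp I X = (∣ X ∣ + rank I (∁ X)) ∸ rank I ⊤

dual : ∀ {n} → IndepFamily n → IndepFamily n
dual I X = rankPerp I X ≡ᵇ ∣ X ∣

IsBasis : ∀ {n} → IndepFamily n → Subset n → Set
IsBasis I B = (I B ≡ true) × (∣ B ∣ ≡ rank I ⊤)

bases : ∀ {n} → IndepFamily n → List (Subset n)
bases {n} I = filter (λ B → T? (I B ∧ (∣ B ∣ ≡ᵇ rank I ⊤))) (allSubsets n)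

IsMaximal : ∀ {n} → IndepFamily n → Subset n → Set
IsMaximal {n} I X = (I X ≡ true) × (∀ (Y : Subset n) → I Y ≡ true → X ⊆ Y → Y ≡ X)

IsPure : ∀ {n} → IndepFamily n → Set
IsPure {n} I = ∀ (X Y : Subset n) → IsMaximal I X → IsMaximal I Y → ∣ X ∣ ≡ ∣ Y ∣

-- Since r_M(E ∖ X) ≤ r_M(E) ≤ |X| + r_M(E ∖ X), we have r_M^⊥(X) = |X| exactly when
-- r_M(E ∖ X) = r_M(E), i.e. when X misses some basis; so r_{M*}(X) is the largest
-- |X ∖ B|.  All bases have size r_M(E), hence max_B |(E ∖ X) ∩ B| =
-- r_M(E) − min_B |X ∩ B|, and (1) at X becomes (2) at E ∖ X.  The basis B maximising
-- |J ∩ B| contains an independent J as soon as r_M(J) = max_B |J ∩ B|, which gives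
-- (2) ⇒ (3); (3) ⇔ (4) because bases are maximal and every independent set extends
-- to a maximal one.  Finally the bases of M* are the complements of the bases of M,
-- so the independent sets of M** are the subsets of bases, which under (3) are
-- exactly the independent sets of M.
module Submission where

open import Defs
open import Data.Nat using (ℕ; _∸_)
open import Data.Fin.Subset using (Subset; ⊤; _∩_; _─_; _⊆_; ∣_∣)
open import Data.Product using (Σ; _×_)
open import Relation.Binary.PropositionalEquality using (_≡_)
open import Function.Bundles using (_⇔_)
open import Data.Bool using (true)

open import Data.Bool using (Bool; false; _∧_)
open import Data.Bool.Properties using (T-≡; ∧-conicalˡ; ∧-conicalʳ; not-involutive)
open import Data.Nat using (suc; _+_; _≤_; _⊔_; _⊓_; _≡ᵇ_; z≤n; s≤s)
open import Data.Nat.Properties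
open import Data.Fin.Subset using (inside; outside; ∁; ⊥; _∈_)
open import Data.Fin.Subset.Properties
open import Data.List using ([]; _∷_; map; filter)
open import Data.List.Membership.Propositional using () renaming (_∈_ to _∈ˡ_)
open import Data.List.Membership.Propositional.Properties using (∈-map⁺; ∈-++⁺ˡ; ∈-++⁺ʳ; ∈-filter⁺; ∈-filter⁻)
open import Data.List.Relation.Unary.Any using (here; there)
open import Data.Vec using ([]; _∷_; here; there)
open import Data.Product using (_,_; proj₁; proj₂; map₂)
open import Data.Sum using (inj₁; inj₂)
open import Function using (_∘_)
open import Function.Bundles using (mk⇔; Equivalence)
open import Relation.Binary.PropositionalEquality using (refl; sym; trans; cong; cong₂; subst; module ≡-Reasoning)
open import Relation.Nullary using (contradiction)
open import Relation.Nullary.Decidable using (T?)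

open Equivalence using (to; from)

∧-true⇔ : ∀ {a b} → a ∧ b ≡ true ⇔ (a ≡ true × b ≡ true)
∧-true⇔ {a} {b} = mk⇔ (λ e → ∧-conicalˡ a b e , ∧-conicalʳ a b e) λ { (refl , refl) → refl }

≡ᵇ-true⇔ : ∀ {m n} → (m ≡ᵇ n) ≡ true ⇔ m ≡ n
≡ᵇ-true⇔ {m} {n} = mk⇔ (≡ᵇ⇒≡ m n ∘ from T-≡) (to T-≡ ∘ ≡⇒≡ᵇ m n)

≡true⇔⇒≡ : ∀ {a b : Bool} → (a ≡ true ⇔ b ≡ true) → a ≡ b
≡true⇔⇒≡ {true}          a⇔b = sym (to a⇔b refl)
≡true⇔⇒≡ {false} {true}  a⇔b = from a⇔b refl
≡true⇔⇒≡ {false} {false} _   = refl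

m∸n≡[m+[o∸n]]∸o : ∀ m {n o} → n ≤ o → m ∸ n ≡ (m + (o ∸ n)) ∸ o
m∸n≡[m+[o∸n]]∸o m {n} {o} n≤o = begin
  m ∸ n                        ≡⟨ sym ([m+n]∸[m+o]≡n∸o (o ∸ n) m n) ⟩
  (o ∸ n + m) ∸ (o ∸ n + n)    ≡⟨ cong₂ _∸_ (+-comm (o ∸ n) m) (m∸n+n≡m n≤o) ⟩
  (m + (o ∸ n)) ∸ o            ∎
  where open ≡-Reasoning

module _ {A : Set} (f : A → ℕ) where

  maxOver-ub : ∀ {a xs} → a ∈ˡ xs → f a ≤ maxOver f xs
  maxOver-ub {xs = x ∷ xs} (here refl) = m≤m⊔n (f x) (maxOver f xs)
  maxOver-ub {xs = x ∷ xs} (there a∈xs) = ≤-trans (maxOver-ub a∈xs) (m≤n⊔m (f x) (maxOver f xs))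

  maxOver-lub : ∀ {m} xs → (∀ {a} → a ∈ˡ xs → f a ≤ m) → maxOver f xs ≤ m
  maxOver-lub []       _   = z≤n
  maxOver-lub (x ∷ xs) f≤m = ⊔-lub (f≤m (here refl)) (maxOver-lub xs (f≤m ∘ there))

  maxOver-attained : ∀ {a xs} → a ∈ˡ xs → Σ A (λ c → c ∈ˡ xs × maxOver f xs ≡ f c)
  maxOver-attained {xs = x ∷ xs} _ = attained x xs
    where
    attained : ∀ x xs → Σ A (λ c → c ∈ˡ x ∷ xs × maxOver f (x ∷ xs) ≡ f c)
    attained x []       = x , here refl , ⊔-identityʳ (f x)
    attained x (y ∷ xs) with attained y xs | ≤-total (f x) (maxOver f (y ∷ xs))
    ... | c , c∈ , max≡fc | inj₁ fx≤max = c , there c∈ , trans (m≤n⇒m⊔n≡n fx≤max) max≡fc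
    ... | _               | inj₂ max≤fx = x , here refl , m≥n⇒m⊔n≡m max≤fx

  minOver-lb : ∀ {a xs} → a ∈ˡ xs → minOver f xs ≤ f a
  minOver-lb {xs = _ ∷ []}     (here refl) = ≤-refl
  minOver-lb {xs = _ ∷ []}     (there ())
  minOver-lb {xs = x ∷ y ∷ xs} (here refl) = m⊓n≤m (f x) (minOver f (y ∷ xs))
  minOver-lb {xs = x ∷ y ∷ xs} (there a∈)  =
    ≤-trans (m⊓n≤n (f x) (minOver f (y ∷ xs))) (minOver-lb a∈)

-- Needs a nonempty list: minOver is 0 on [], while maxOver of k ∸ g would be 0, not k.
maxOver≡∸minOver : ∀ {A : Set} (f g : A → ℕ) k {a xs} →
                   (∀ {b} → b ∈ˡ xs → f b ≡ k ∸ g b) → a ∈ˡ xs →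
                   maxOver f xs ≡ k ∸ minOver g xs
maxOver≡∸minOver f g k {xs = x ∷ xs} f≡k∸g _ = go x xs f≡k∸g
  where
  open ≡-Reasoning
  go : ∀ x xs → (∀ {b} → b ∈ˡ x ∷ xs → f b ≡ k ∸ g b) →
       maxOver f (x ∷ xs) ≡ k ∸ minOver g (x ∷ xs)
  go x []       f≡k∸g = trans (⊔-identityʳ (f x)) (f≡k∸g (here refl))
  go x (y ∷ xs) f≡k∸g = begin
    f x ⊔ maxOver f (y ∷ xs)              ≡⟨ cong₂ _⊔_ (f≡k∸g (here refl)) (go y xs (f≡k∸g ∘ there)) ⟩
    (k ∸ g x) ⊔ (k ∸ minOver g (y ∷ xs))  ≡⟨ sym (∸-distribˡ-⊓-⊔ k (g x) (minOver g (y ∷ xs))) ⟩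
    k ∸ (g x ⊓ minOver g (y ∷ xs))        ∎

∁-involutive : ∀ {n} (p : Subset n) → ∁ (∁ p) ≡ p
∁-involutive []      = refl
∁-involutive (x ∷ p) = cong₂ _∷_ (not-involutive x) (∁-involutive p)

p⊆∁q⇒q⊆∁p : ∀ {n} {p q : Subset n} → p ⊆ ∁ q → q ⊆ ∁ p
p⊆∁q⇒q⊆∁p p⊆∁q x∈q = x∉p⇒x∈∁p (λ x∈p → x∈∁p⇒x∉p (p⊆∁q x∈p) x∈q)

p─q⊆∁q : ∀ {n} {p q : Subset n} → p ─ q ⊆ ∁ q
p─q⊆∁q {p = inside ∷ _} {outside ∷ _} here          = here
p─q⊆∁q {p = _ ∷ _}      {outside ∷ _} (there x∈p─q) = there (p─q⊆∁q x∈p─q)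
p─q⊆∁q {p = _ ∷ _}      {inside  ∷ _} (there x∈p─q) = there (p─q⊆∁q x∈p─q)

∣p∩q∣+∣p─q∣≡∣p∣ : ∀ {n} (p q : Subset n) → ∣ p ∩ q ∣ + ∣ p ─ q ∣ ≡ ∣ p ∣
∣p∩q∣+∣p─q∣≡∣p∣ []            []            = refl
∣p∩q∣+∣p─q∣≡∣p∣ (inside  ∷ p) (inside  ∷ q) = cong suc (∣p∩q∣+∣p─q∣≡∣p∣ p q)
∣p∩q∣+∣p─q∣≡∣p∣ (inside  ∷ p) (outside ∷ q) = trans (+-suc ∣ p ∩ q ∣ ∣ p ─ q ∣) (cong suc (∣p∩q∣+∣p─q∣≡∣p∣ p q))
∣p∩q∣+∣p─q∣≡∣p∣ (outside ∷ p) (inside  ∷ q) = ∣p∩q∣+∣p─q∣≡∣p∣ p q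
∣p∩q∣+∣p─q∣≡∣p∣ (outside ∷ p) (outside ∷ q) = ∣p∩q∣+∣p─q∣≡∣p∣ p q

∣p∩q∣+∣∁p∩q∣≡∣q∣ : ∀ {n} (p q : Subset n) → ∣ p ∩ q ∣ + ∣ ∁ p ∩ q ∣ ≡ ∣ q ∣
∣p∩q∣+∣∁p∩q∣≡∣q∣ []            []            = refl
∣p∩q∣+∣∁p∩q∣≡∣q∣ (inside  ∷ p) (inside  ∷ q) = cong suc (∣p∩q∣+∣∁p∩q∣≡∣q∣ p q)
∣p∩q∣+∣∁p∩q∣≡∣q∣ (outside ∷ p) (inside  ∷ q) = trans (+-suc ∣ p ∩ q ∣ ∣ ∁ p ∩ q ∣) (cong suc (∣p∩q∣+∣∁p∩q∣≡∣q∣ p q))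
∣p∩q∣+∣∁p∩q∣≡∣q∣ (inside  ∷ p) (outside ∷ q) = ∣p∩q∣+∣∁p∩q∣≡∣q∣ p q
∣p∩q∣+∣∁p∩q∣≡∣q∣ (outside ∷ p) (outside ∷ q) = ∣p∩q∣+∣∁p∩q∣≡∣q∣ p q

∣p─q∣≡∣p∣∸∣p∩q∣ : ∀ {n} (p q : Subset n) → ∣ p ─ q ∣ ≡ ∣ p ∣ ∸ ∣ p ∩ q ∣
∣p─q∣≡∣p∣∸∣p∩q∣ p q =
  trans (sym (m+n∸m≡n ∣ p ∩ q ∣ ∣ p ─ q ∣)) (cong (_∸ ∣ p ∩ q ∣) (∣p∩q∣+∣p─q∣≡∣p∣ p q))

∣∁p∩q∣≡∣q∣∸∣p∩q∣ : ∀ {n} (p q : Subset n) → ∣ ∁ p ∩ q ∣ ≡ ∣ q ∣ ∸ ∣ p ∩ q ∣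
∣∁p∩q∣≡∣q∣∸∣p∩q∣ p q =
  trans (sym (m+n∸m≡n ∣ p ∩ q ∣ ∣ ∁ p ∩ q ∣)) (cong (_∸ ∣ p ∩ q ∣) (∣p∩q∣+∣∁p∩q∣≡∣q∣ p q))

p⊆q∧∣q∣≤∣p∣⇒p≡q : ∀ {n} {p q : Subset n} → p ⊆ q → ∣ q ∣ ≤ ∣ p ∣ → p ≡ q
p⊆q∧∣q∣≤∣p∣⇒p≡q {p = []}          {[]}          _   _           = refl
p⊆q∧∣q∣≤∣p∣⇒p≡q {p = inside  ∷ p} {inside  ∷ q} p⊆q (s≤s ∣q∣≤∣p∣) =
  cong (inside ∷_) (p⊆q∧∣q∣≤∣p∣⇒p≡q (drop-∷-⊆ p⊆q) ∣q∣≤∣p∣)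
p⊆q∧∣q∣≤∣p∣⇒p≡q {p = outside ∷ p} {outside ∷ q} p⊆q ∣q∣≤∣p∣ =
  cong (outside ∷_) (p⊆q∧∣q∣≤∣p∣⇒p≡q (drop-∷-⊆ p⊆q) ∣q∣≤∣p∣)
p⊆q∧∣q∣≤∣p∣⇒p≡q {p = inside  ∷ p} {outside ∷ q} p⊆q _ = contradiction (p⊆q here) λ ()
p⊆q∧∣q∣≤∣p∣⇒p≡q {p = outside ∷ p} {inside  ∷ q} p⊆q ∣q∣≤∣p∣ =
  contradiction ∣q∣≤∣p∣ (<⇒≱ (s≤s (p⊆q⇒∣p∣≤∣q∣ (drop-∷-⊆ p⊆q))))

∣p∣≤∣p∩q∣⇒p⊆q : ∀ {n} {p q : Subset n} → ∣ p ∣ ≤ ∣ p ∩ q ∣ → p ⊆ q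
∣p∣≤∣p∩q∣⇒p⊆q {p = p} {q} ∣p∣≤∣p∩q∣ x∈p =
  p∩q⊆q p q (subst (_ ∈_) (sym (p⊆q∧∣q∣≤∣p∣⇒p≡q (p∩q⊆p p q) ∣p∣≤∣p∩q∣)) x∈p)

subsetᵇ⇒⊆ : ∀ {n} {p q : Subset n} → subsetᵇ p q ≡ true → p ⊆ q
subsetᵇ⇒⊆ {p = inside  ∷ _} {inside ∷ _} _  here        = here
subsetᵇ⇒⊆ {p = inside  ∷ _} {inside ∷ _} p⊆q (there x∈p) = there (subsetᵇ⇒⊆ p⊆q x∈p)
subsetᵇ⇒⊆ {p = outside ∷ _} {_ ∷ _}      p⊆q (there x∈p) = there (subsetᵇ⇒⊆ p⊆q x∈p)

⊆⇒subsetᵇ : ∀ {n} {p q : Subset n} → p ⊆ q → subsetᵇ p q ≡ true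
⊆⇒subsetᵇ {p = []}          {[]}          _   = refl
⊆⇒subsetᵇ {p = inside  ∷ _} {inside  ∷ _} p⊆q = ⊆⇒subsetᵇ (drop-∷-⊆ p⊆q)
⊆⇒subsetᵇ {p = inside  ∷ _} {outside ∷ _} p⊆q = contradiction (p⊆q here) λ ()
⊆⇒subsetᵇ {p = outside ∷ _} {_ ∷ _}       p⊆q = ⊆⇒subsetᵇ (drop-∷-⊆ p⊆q)

∈-allSubsets : ∀ {n} (p : Subset n) → p ∈ˡ allSubsets n
∈-allSubsets []                      = here refl
∈-allSubsets {suc n} (inside  ∷ p) = ∈-++⁺ˡ (∈-map⁺ (inside ∷_) (∈-allSubsets p))
∈-allSubsets {suc n} (outside ∷ p) =
  ∈-++⁺ʳ (map (inside ∷_) (allSubsets n)) (∈-map⁺ (outside ∷_) (∈-allSubsets p))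

∈-filter-allSubsets : ∀ {n} (P : Subset n → Bool) {p} →
                      p ∈ˡ filter (λ q → T? (P q)) (allSubsets n) ⇔ P p ≡ true
∈-filter-allSubsets {n} P {p} = mk⇔
  (to T-≡ ∘ proj₂ ∘ ∈-filter⁻ (T? ∘ P) {xs = allSubsets n})
  (∈-filter⁺ (T? ∘ P) (∈-allSubsets p) ∘ from T-≡)

module _ {n : ℕ} (I : IndepFamily n) where

  ∈-indepSubsets⇔ : ∀ {X Y} →
    Y ∈ˡ filter (λ Z → T? (I Z ∧ subsetᵇ Z X)) (allSubsets n) ⇔ (I Y ≡ true × Y ⊆ X)
  ∈-indepSubsets⇔ {X} = mk⇔
    (λ Y∈ → map₂ subsetᵇ⇒⊆ (to ∧-true⇔ (to (∈-filter-allSubsets _) Y∈)))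
    (λ (IY , Y⊆X) → from (∈-filter-allSubsets _) (from ∧-true⇔ (IY , ⊆⇒subsetᵇ Y⊆X)))

  rank-ub : ∀ {X Y} → I Y ≡ true → Y ⊆ X → ∣ Y ∣ ≤ rank I X
  rank-ub IY Y⊆X = maxOver-ub ∣_∣ (from ∈-indepSubsets⇔ (IY , Y⊆X))

  rank-lub : ∀ {X m} → (∀ {Y} → I Y ≡ true → Y ⊆ X → ∣ Y ∣ ≤ m) → rank I X ≤ m
  rank-lub bound = maxOver-lub ∣_∣ _ (λ Y∈ → let IY , Y⊆X = to ∈-indepSubsets⇔ Y∈ in bound IY Y⊆X)

  rank-attained : ∀ {X Y} → I Y ≡ true → Y ⊆ X →
                  Σ (Subset n) (λ Z → I Z ≡ true × Z ⊆ X × ∣ Z ∣ ≡ rank I X)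
  rank-attained IY Y⊆X with maxOver-attained ∣_∣ (from ∈-indepSubsets⇔ (IY , Y⊆X))
  ... | Z , Z∈ , rank≡∣Z∣ = let IZ , Z⊆X = to ∈-indepSubsets⇔ Z∈ in Z , IZ , Z⊆X , sym rank≡∣Z∣

  rank≤rank⊤ : ∀ X → rank I X ≤ rank I ⊤
  rank≤rank⊤ X = rank-lub (λ IY _ → rank-ub IY ⊆⊤)

  ∈-bases⇔ : ∀ {B} → B ∈ˡ bases I ⇔ IsBasis I B
  ∈-bases⇔ = mk⇔
    (λ B∈ → let IB , ∣B∣≡ᵇ = to ∧-true⇔ (to (∈-filter-allSubsets _) B∈) in IB , to ≡ᵇ-true⇔ ∣B∣≡ᵇ)
    (λ (IB , ∣B∣≡) → from (∈-filter-allSubsets _) (from ∧-true⇔ (IB , from ≡ᵇ-true⇔ ∣B∣≡)))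

  IsBasis⇒IsMaximal : ∀ {B} → IsBasis I B → IsMaximal I B
  IsBasis⇒IsMaximal (IB , ∣B∣≡rank⊤) = IB , λ Y IY B⊆Y →
    sym (p⊆q∧∣q∣≤∣p∣⇒p≡q B⊆Y (subst (∣ Y ∣ ≤_) (sym ∣B∣≡rank⊤) (rank-ub IY ⊆⊤)))

-- A largest set among the independent supersets of J is maximal.
extend-to-maximal : ∀ {n} {I : IndepFamily n} {J} → I J ≡ true →
                    Σ (Subset n) (λ K → IsMaximal I K × J ⊆ K)
extend-to-maximal {I = I} {J} IJ
  with rank-attained (λ K → I K ∧ subsetᵇ J K) (from ∧-true⇔ (IJ , ⊆⇒subsetᵇ {p = J} ⊆-refl)) ⊆⊤
... | K , IK∧J⊆ᵇK , _ , ∣K∣≡rank = K , (IK , maximal) , J⊆K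
  where
  IK : I K ≡ true
  IK = proj₁ (to ∧-true⇔ IK∧J⊆ᵇK)
  J⊆K : J ⊆ K
  J⊆K = subsetᵇ⇒⊆ (proj₂ (to ∧-true⇔ IK∧J⊆ᵇK))
  maximal : ∀ Y → I Y ≡ true → K ⊆ Y → Y ≡ K
  maximal Y IY K⊆Y = sym (p⊆q∧∣q∣≤∣p∣⇒p≡q K⊆Y (subst (∣ Y ∣ ≤_) (sym ∣K∣≡rank)
    (rank-ub (λ K → I K ∧ subsetᵇ J K) (from ∧-true⇔ (IY , ⊆⇒subsetᵇ (⊆-trans J⊆K K⊆Y))) ⊆⊤)))

maxBasisMeet minBasisMeet : ∀ {n} → IndepFamily n → Subset n → ℕ
maxBasisMeet I X = maxOver (λ B → ∣ X ∩ B ∣) (bases I)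
minBasisMeet I X = minOver (λ B → ∣ X ∩ B ∣) (bases I)

DualRankIsPerp RankIsMaxBasisMeet IndepExtendsToBasis : ∀ {n} → IndepFamily n → Set
DualRankIsPerp {n} I      = ∀ (X : Subset n) → rank (dual I) X ≡ rankPerp I X
RankIsMaxBasisMeet {n} I  = ∀ (X : Subset n) → rank I X ≡ maxBasisMeet I X
IndepExtendsToBasis {n} I = ∀ (J : Subset n) → I J ≡ true → Σ (Subset n) (λ B → IsBasis I B × J ⊆ B)

module _ {n : ℕ} {I : IndepFamily n} (isIndep : IsIndepSystem I) where

  indep-⊆ : ∀ {X Y} → Y ⊆ X → I X ≡ true → I Y ≡ true
  indep-⊆ {X} {Y} = proj₂ isIndep X Y

  basis-exists : Σ (Subset n) (IsBasis I)
  basis-exists with rank-attained I (proj₁ isIndep) (⊆⊤ {p = ⊥})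
  ... | B , IB , _ , ∣B∣≡rank⊤ = B , IB , ∣B∣≡rank⊤

  private
    B₀ : Subset n
    B₀ = proj₁ basis-exists

    B₀-basis : IsBasis I B₀
    B₀-basis = proj₂ basis-exists

    B₀∈bases : B₀ ∈ˡ bases I
    B₀∈bases = from (∈-bases⇔ I) B₀-basis

  maxBasisMeet≤rank : ∀ X → maxBasisMeet I X ≤ rank I X
  maxBasisMeet≤rank X = maxOver-lub _ (bases I) λ {B} B∈ →
    rank-ub I (indep-⊆ (p∩q⊆q X B) (proj₁ (to (∈-bases⇔ I) B∈))) (p∩q⊆p X B)

  rank⊤≤∣X∣+maxBasisMeet∁ : ∀ X → rank I ⊤ ≤ ∣ X ∣ + maxBasisMeet I (∁ X)
  rank⊤≤∣X∣+maxBasisMeet∁ X = begin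
    rank I ⊤                     ≡⟨ sym (proj₂ B₀-basis) ⟩
    ∣ B₀ ∣                       ≡⟨ sym (∣p∩q∣+∣∁p∩q∣≡∣q∣ X B₀) ⟩
    ∣ X ∩ B₀ ∣ + ∣ ∁ X ∩ B₀ ∣    ≤⟨ +-mono-≤ (∣p∩q∣≤∣p∣ X B₀) (maxOver-ub _ B₀∈bases) ⟩
    ∣ X ∣ + maxBasisMeet I (∁ X) ∎
    where open ≤-Reasoning

  rank⊤≤∣X∣+rank∁ : ∀ X → rank I ⊤ ≤ ∣ X ∣ + rank I (∁ X)
  rank⊤≤∣X∣+rank∁ X =
    ≤-trans (rank⊤≤∣X∣+maxBasisMeet∁ X) (+-monoʳ-≤ ∣ X ∣ (maxBasisMeet≤rank (∁ X)))

  rank≡rank⊤⇔basis⊆ : ∀ {X} → rank I X ≡ rank I ⊤ ⇔ Σ (Subset n) (λ B → IsBasis I B × B ⊆ X)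
  rank≡rank⊤⇔basis⊆ {X} = mk⇔ contains-basis
    (λ (B , (IB , ∣B∣≡rank⊤) , B⊆X) →
      ≤-antisym (rank≤rank⊤ I X) (subst (_≤ rank I X) ∣B∣≡rank⊤ (rank-ub I IB B⊆X)))
    where
    contains-basis : rank I X ≡ rank I ⊤ → Σ (Subset n) (λ B → IsBasis I B × B ⊆ X)
    contains-basis rank≡ with rank-attained I (proj₁ isIndep) (⊥⊆ {p = X})
    ... | B , IB , B⊆X , ∣B∣≡rank = B , (IB , trans ∣B∣≡rank rank≡) , B⊆X

  rankPerp≡∣X∣⇔rank∁≡rank⊤ : ∀ {X} → rankPerp I X ≡ ∣ X ∣ ⇔ rank I (∁ X) ≡ rank I ⊤
  rankPerp≡∣X∣⇔rank∁≡rank⊤ {X} = mk⇔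
    (λ perp≡ → +-cancelˡ-≡ ∣ X ∣ _ _ (begin
      ∣ X ∣ + rank I (∁ X)       ≡⟨ sym (m∸n+n≡m (rank⊤≤∣X∣+rank∁ X)) ⟩
      rankPerp I X + rank I ⊤    ≡⟨ cong (_+ rank I ⊤) perp≡ ⟩
      ∣ X ∣ + rank I ⊤           ∎))
    (λ rank∁≡ → trans (cong (λ r → (∣ X ∣ + r) ∸ rank I ⊤) rank∁≡) (m+n∸n≡m ∣ X ∣ (rank I ⊤)))
    where open ≡-Reasoning

  dual-indep⇔ : ∀ {X} → dual I X ≡ true ⇔ Σ (Subset n) (λ B → IsBasis I B × X ⊆ ∁ B)
  dual-indep⇔ = mk⇔
    (map₂ (map₂ p⊆∁q⇒q⊆∁p) ∘ to rank≡rank⊤⇔basis⊆ ∘ to rankPerp≡∣X∣⇔rank∁≡rank⊤ ∘ to ≡ᵇ-true⇔)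
    (from ≡ᵇ-true⇔ ∘ from rankPerp≡∣X∣⇔rank∁≡rank⊤ ∘ from rank≡rank⊤⇔basis⊆ ∘ map₂ (map₂ p⊆∁q⇒q⊆∁p))

  dual-isIndepSystem : IsIndepSystem (dual I)
  dual-isIndepSystem = from dual-indep⇔ (B₀ , B₀-basis , ⊥⊆)
                     , λ X Y Y⊆X → from dual-indep⇔ ∘ map₂ (map₂ (⊆-trans Y⊆X)) ∘ to dual-indep⇔

  rank-dual≡maxOver─ : ∀ X → rank (dual I) X ≡ maxOver (λ B → ∣ X ─ B ∣) (bases I)
  rank-dual≡maxOver─ X = ≤-antisym (rank-lub (dual I) ≤max) max≤
    where
    ≤max : ∀ {Y} → dual I Y ≡ true → Y ⊆ X → ∣ Y ∣ ≤ maxOver (λ B → ∣ X ─ B ∣) (bases I)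
    ≤max dY Y⊆X with to dual-indep⇔ dY
    ... | B , bB , Y⊆∁B = ≤-trans
      (p⊆q⇒∣p∣≤∣q∣ λ x∈Y → x∈p∧x∉q⇒x∈p─q (Y⊆X x∈Y) (x∈∁p⇒x∉p (Y⊆∁B x∈Y)))
      (maxOver-ub _ (from (∈-bases⇔ I) bB))
    max≤ : maxOver (λ B → ∣ X ─ B ∣) (bases I) ≤ rank (dual I) X
    max≤ with maxOver-attained (λ B → ∣ X ─ B ∣) B₀∈bases
    ... | B , B∈ , max≡ = subst (_≤ rank (dual I) X) (sym max≡)
      (rank-ub (dual I) (from dual-indep⇔ (B , to (∈-bases⇔ I) B∈ , p─q⊆∁q)) (p─q⊆p X B))

  rank-dual≡∣X∣∸minBasisMeet : ∀ X → rank (dual I) X ≡ ∣ X ∣ ∸ minBasisMeet I X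
  rank-dual≡∣X∣∸minBasisMeet X = trans (rank-dual≡maxOver─ X)
    (maxOver≡∸minOver _ _ ∣ X ∣ (λ {B} _ → ∣p─q∣≡∣p∣∸∣p∩q∣ X B) B₀∈bases)

  maxBasisMeet∁≡rank⊤∸minBasisMeet : ∀ X → maxBasisMeet I (∁ X) ≡ rank I ⊤ ∸ minBasisMeet I X
  maxBasisMeet∁≡rank⊤∸minBasisMeet X = maxOver≡∸minOver _ _ (rank I ⊤)
    (λ {B} B∈ → trans (∣∁p∩q∣≡∣q∣∸∣p∩q∣ X B) (cong (_∸ ∣ X ∩ B ∣) (proj₂ (to (∈-bases⇔ I) B∈))))
    B₀∈bases

  minBasisMeet≤rank⊤ : ∀ X → minBasisMeet I X ≤ rank I ⊤
  minBasisMeet≤rank⊤ X = ≤-trans (minOver-lb _ B₀∈bases)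
    (≤-trans (∣p∩q∣≤∣q∣ X B₀) (≤-reflexive (proj₂ B₀-basis)))

  rank-dual≡[∣X∣+maxBasisMeet∁]∸rank⊤ : ∀ X →
    rank (dual I) X ≡ (∣ X ∣ + maxBasisMeet I (∁ X)) ∸ rank I ⊤
  rank-dual≡[∣X∣+maxBasisMeet∁]∸rank⊤ X = begin
    rank (dual I) X                                    ≡⟨ rank-dual≡∣X∣∸minBasisMeet X ⟩
    ∣ X ∣ ∸ minBasisMeet I X                           ≡⟨ m∸n≡[m+[o∸n]]∸o ∣ X ∣ (minBasisMeet≤rank⊤ X) ⟩
    (∣ X ∣ + (rank I ⊤ ∸ minBasisMeet I X)) ∸ rank I ⊤ ≡⟨ cong (λ m → (∣ X ∣ + m) ∸ rank I ⊤)
                                                             (sym (maxBasisMeet∁≡rank⊤∸minBasisMeet X)) ⟩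
    (∣ X ∣ + maxBasisMeet I (∁ X)) ∸ rank I ⊤          ∎
    where open ≡-Reasoning

  dualRankIsPerp⇔rankIsMaxBasisMeet : DualRankIsPerp I ⇔ RankIsMaxBasisMeet I
  dualRankIsPerp⇔rankIsMaxBasisMeet = mk⇔
    (λ perp Y → subst (λ Z → rank I Z ≡ maxBasisMeet I Z) (∁-involutive Y) (sym (at∁ perp (∁ Y))))
    (λ rank≡ X → trans (rank-dual≡[∣X∣+maxBasisMeet∁]∸rank⊤ X)
                       (cong (λ m → (∣ X ∣ + m) ∸ rank I ⊤) (sym (rank≡ (∁ X)))))
    where
    at∁ : DualRankIsPerp I → ∀ X → maxBasisMeet I (∁ X) ≡ rank I (∁ X)
    at∁ perp X = +-cancelˡ-≡ ∣ X ∣ _ _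
      (∸-cancelʳ-≡ (rank⊤≤∣X∣+maxBasisMeet∁ X) (rank⊤≤∣X∣+rank∁ X)
        (trans (sym (rank-dual≡[∣X∣+maxBasisMeet∁]∸rank⊤ X)) (perp X)))

  rankIsMaxBasisMeet⇔indepExtendsToBasis : RankIsMaxBasisMeet I ⇔ IndepExtendsToBasis I
  rankIsMaxBasisMeet⇔indepExtendsToBasis = mk⇔ extends rank≡
    where
    extends : RankIsMaxBasisMeet I → IndepExtendsToBasis I
    extends rank≡ J IJ with maxOver-attained (λ B → ∣ J ∩ B ∣) B₀∈bases
    ... | B , B∈ , max≡ = B , to (∈-bases⇔ I) B∈ ,
      ∣p∣≤∣p∩q∣⇒p⊆q (subst (∣ J ∣ ≤_) (trans (rank≡ J) max≡) (rank-ub I IJ ⊆-refl))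

    rank≡ : IndepExtendsToBasis I → RankIsMaxBasisMeet I
    rank≡ ext X = ≤-antisym rank≤ (maxBasisMeet≤rank X)
      where
      rank≤ : rank I X ≤ maxBasisMeet I X
      rank≤ with rank-attained I (proj₁ isIndep) (⊥⊆ {p = X})
      ... | Y , IY , Y⊆X , ∣Y∣≡rank with ext Y IY
      ... | B , bB , Y⊆B = subst (_≤ maxBasisMeet I X) ∣Y∣≡rank (≤-trans
        (p⊆q⇒∣p∣≤∣q∣ λ x∈Y → x∈p∩q⁺ (Y⊆X x∈Y , Y⊆B x∈Y))
        (maxOver-ub _ (from (∈-bases⇔ I) bB)))

  indepExtendsToBasis⇔pure : IndepExtendsToBasis I ⇔ IsPure I
  indepExtendsToBasis⇔pure = mk⇔
    (λ ext X Y mX mY → trans (∣maximal∣≡rank⊤ ext mX) (sym (∣maximal∣≡rank⊤ ext mY)))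
    (λ pure J IJ → let K , mK , J⊆K = extend-to-maximal IJ in
      K , (proj₁ mK , trans (pure K B₀ mK (IsBasis⇒IsMaximal I B₀-basis)) (proj₂ B₀-basis)) , J⊆K)
    where
    ∣maximal∣≡rank⊤ : IndepExtendsToBasis I → ∀ {Z} → IsMaximal I Z → ∣ Z ∣ ≡ rank I ⊤
    ∣maximal∣≡rank⊤ ext (IZ , maxZ) with ext _ IZ
    ... | B , (IB , ∣B∣≡rank⊤) , Z⊆B = trans (cong ∣_∣ (sym (maxZ B IB Z⊆B))) ∣B∣≡rank⊤

  ∣∁basis∣≡n∸rank⊤ : ∀ {B} → IsBasis I B → ∣ ∁ B ∣ ≡ n ∸ rank I ⊤
  ∣∁basis∣≡n∸rank⊤ {B} (_ , ∣B∣≡rank⊤) = trans (∣∁p∣≡n∸∣p∣ B) (cong (n ∸_) ∣B∣≡rank⊤)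

  rank-dual⊤≡n∸rank⊤ : rank (dual I) ⊤ ≡ n ∸ rank I ⊤
  rank-dual⊤≡n∸rank⊤ = ≤-antisym
    (rank-lub (dual I) λ dY _ → let B , bB , Y⊆∁B = to dual-indep⇔ dY in
      ≤-trans (p⊆q⇒∣p∣≤∣q∣ Y⊆∁B) (≤-reflexive (∣∁basis∣≡n∸rank⊤ bB)))
    (subst (_≤ rank (dual I) ⊤) (∣∁basis∣≡n∸rank⊤ B₀-basis)
      (rank-ub (dual I) (from dual-indep⇔ (B₀ , B₀-basis , ⊆-refl)) ⊆⊤))

  dual-basis⇔ : ∀ {C} → IsBasis (dual I) C ⇔ Σ (Subset n) (λ B → IsBasis I B × C ≡ ∁ B)
  dual-basis⇔ = mk⇔ complement-of-basis
    (λ { (B , bB , refl) → from dual-indep⇔ (B , bB , ⊆-refl)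
                         , trans (∣∁basis∣≡n∸rank⊤ bB) (sym rank-dual⊤≡n∸rank⊤) })
    where
    complement-of-basis : ∀ {C} → IsBasis (dual I) C → Σ (Subset n) (λ B → IsBasis I B × C ≡ ∁ B)
    complement-of-basis (dC , ∣C∣≡rank⊤) with to dual-indep⇔ dC
    ... | B , bB , C⊆∁B = B , bB , p⊆q∧∣q∣≤∣p∣⇒p≡q C⊆∁B
      (≤-reflexive (trans (∣∁basis∣≡n∸rank⊤ bB) (trans (sym rank-dual⊤≡n∸rank⊤) (sym ∣C∣≡rank⊤))))

dual-dual-indep⇔ : ∀ {n} {I : IndepFamily n} → IsIndepSystem I →
                   ∀ {X} → dual (dual I) X ≡ true ⇔ Σ (Subset n) (λ B → IsBasis I B × X ⊆ B)
dual-dual-indep⇔ {n} {I} isIndep {X} = mk⇔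
  (contained-in-basis ∘ to (dual-indep⇔ (dual-isIndepSystem isIndep)))
  (λ (B , bB , X⊆B) → from (dual-indep⇔ (dual-isIndepSystem isIndep))
    (∁ B , from (dual-basis⇔ isIndep) (B , bB , refl) , p⊆∁q⇒q⊆∁p (p⊆q⇒∁p⊇∁q X⊆B)))
  where
  contained-in-basis : Σ (Subset n) (λ C → IsBasis (dual I) C × X ⊆ ∁ C) →
                       Σ (Subset n) (λ B → IsBasis I B × X ⊆ B)
  contained-in-basis (C , bC , X⊆∁C) with to (dual-basis⇔ isIndep) bC
  ... | B , bB , refl = B , bB , ∁p⊆∁q⇒p⊇q (p⊆∁q⇒q⊆∁p X⊆∁C)

dual-dual≡ : ∀ {n} {I : IndepFamily n} → IsIndepSystem I → IndepExtendsToBasis I →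
             ∀ X → dual (dual I) X ≡ I X
dual-dual≡ isIndep ext X = ≡true⇔⇒≡ (mk⇔
  (λ ddX → let B , (IB , _) , X⊆B = to (dual-dual-indep⇔ isIndep) ddX in indep-⊆ isIndep X⊆B IB)
  (from (dual-dual-indep⇔ isIndep) ∘ ext X))

proposition4p20 : ∀ (n : ℕ) (I : IndepFamily n) → IsIndepSystem I →
    (∀ (X : Subset n) →
        (rank (dual I) X ≡ maxOver (λ B → ∣ X ─ B ∣) (bases I))
      × (rank (dual I) X ≡ ∣ X ∣ ∸ minOver (λ B → ∣ X ∩ B ∣) (bases I)))
  × (((∀ (X : Subset n) → rank (dual I) X ≡ rankPerp I X)
        ⇔ (∀ (X : Subset n) → rank I X ≡ maxOver (λ B → ∣ X ∩ B ∣) (bases I)))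
    × ((∀ (X : Subset n) → rank I X ≡ maxOver (λ B → ∣ X ∩ B ∣) (bases I))
        ⇔ (∀ (J : Subset n) → I J ≡ true → Σ (Subset n) (λ B → IsBasis I B × (J ⊆ B))))
    × ((∀ (J : Subset n) → I J ≡ true → Σ (Subset n) (λ B → IsBasis I B × (J ⊆ B)))
        ⇔ IsPure I))
  × (IsPure I → ∀ (X : Subset n) → dual (dual I) X ≡ I X)
proposition4p20 n I isIndep =
    (λ X → rank-dual≡maxOver─ isIndep X , rank-dual≡∣X∣∸minBasisMeet isIndep X)
  , ( dualRankIsPerp⇔rankIsMaxBasisMeet isIndep
    , rankIsMaxBasisMeet⇔indepExtendsToBasis isIndep
    , indepExtendsToBasis⇔pure isIndep )
  , dual-dual≡ isIndep ∘ from (indepExtendsToBasis⇔pure isIndep)
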